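{- For independent indeterminates $x,y$, $$I_{3,1}(x,y)\stackrel{\delta}{=}I_{3,1}(1-x,1-y)\stackrel{\delta}{=}I_{3,1}\Big(\frac1x,\frac1y\Big)\stackrel{\delta}{=}I_{3,1}\Big(\frac1{1-x},\frac1{1-y}\Big)\stackrel{\delta}{=}I_{3,1}\Big(1-\frac1x,1-\frac1y\Big)\stackrel{\delta}{=}I_{3,1}\Big(\frac x{x-1},\frac y{y-1}\Big).$$
   Context: Let $F=\mathbb{Q}(x,y)$, $V=F^\times\otimes_{\mathbb Z}\mathbb{Q}$ (multiplicative notation inside tensors). The symbol of Goncharov's iterated integral is defined recursively by $\mathcal S(I(a_0;\,;a_1))=1$ and $\mathcal S(I(a_0;a_1,\dots,a_n;a_{n+1}))=\sum_{i=1}^n\mathcal S(I(a_0;\dots,\widehat{a_i},\dots;a_{n+1}))\otimes\frac{a_i-a_{i+1}}{a_i-a_{i-1}}$ (zero factors omitted); $I_{3,1}(u,v):=I(0;u,0,0,v;1)$. $\pi:V^{\otimes4}\to\bigwedge^2(\bigwedge^2V)$ is the linear map $a\otimes b\otimes c\otimes d\mapsto(a\wedge b)\wedge(c\wedge d)$, and $X\stackrel{\delta}{=}Y$ means $\pi(\mathcal S(X))=\pi(\mathcal S(Y))$ (equality modulo products and lower depth, in particular modulo $\mathrm{Li}_4$-terms). -}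

module Defs where

open import Data.Rational using (ℚ; 0ℚ; 1ℚ) renaming (_+_ to _+q_; _*_ to _*q_; -_ to -q_)
open import Data.Rational.Properties using () renaming (_≟_ to _≟q_)
open import Data.List using (List; []; _∷_; map; concatMap; null; _++_)
open import Data.Bool using (Bool; true; false; T; not; _∧_; if_then_else_)
open import Data.Unit using (tt)
open import Data.Product using (Σ; _×_; _,_; proj₁)
open import Data.Nat using (ℕ; zero; suc)
open import Data.Fin using (Fin; inject₁) renaming (zero to fzero; suc to fsuc)
open import Data.Vec using (Vec; _∷_; _∷ʳ_; lookup; removeAt; allFin; toList; _[_]≔_)
  renaming ([] to []v)
open import Relation.Nullary using (does)
open import Relation.Binary.PropositionalEquality using (_≡_; refl; subst; sym)

-- Polynomials in ℚ[x,y], dense representation, kept in normal form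
-- (no trailing zero coefficients), so that _≡_ on normal forms is
-- equality of polynomials.

Poly1 : Set            -- ℚ[y]: list of coefficients of y^0, y^1, ...
Poly1 = List ℚ

Poly2 : Set            -- ℚ[y][x]: list of coefficients (in ℚ[y]) of x^0, x^1, ...
Poly2 = List Poly1

isZeroℚ : ℚ → Bool
isZeroℚ q = does (q ≟q 0ℚ)

cons1 : ℚ → Poly1 → Poly1
cons1 c []      = if isZeroℚ c then [] else (c ∷ [])
cons1 c (d ∷ r) = c ∷ d ∷ r

norm1 : Poly1 → Poly1
norm1 []       = []
norm1 (c ∷ cs) = cons1 c (norm1 cs)

add1 : Poly1 → Poly1 → Poly1
add1 []      q       = q
add1 (a ∷ p) []      = a ∷ p
add1 (a ∷ p) (b ∷ q) = (a +q b) ∷ add1 p q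

mul1 : Poly1 → Poly1 → Poly1
mul1 []      q = []
mul1 (a ∷ p) q = add1 (map (a *q_) q) (0ℚ ∷ mul1 p q)

cons2 : Poly1 → Poly2 → Poly2
cons2 [] []      = []
cons2 c  (d ∷ r) = c ∷ d ∷ r
cons2 (a ∷ c) [] = (a ∷ c) ∷ []

norm2 : Poly2 → Poly2
norm2 []       = []
norm2 (c ∷ cs) = cons2 (norm1 c) (norm2 cs)

add2 : Poly2 → Poly2 → Poly2
add2 []      q       = q
add2 (a ∷ p) []      = a ∷ p
add2 (a ∷ p) (b ∷ q) = add1 a b ∷ add2 p q

mul2 : Poly2 → Poly2 → Poly2
mul2 []      q = []
mul2 (a ∷ p) q = add2 (map (mul1 a) q) ([] ∷ mul2 p q)

neg2 : Poly2 → Poly2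
neg2 = map (map -q_)

_+P_ _*P_ _-P_ : Poly2 → Poly2 → Poly2
p +P q = norm2 (add2 p q)
p *P q = norm2 (mul2 p q)
p -P q = norm2 (add2 p (neg2 q))

isZeroP : Poly2 → Bool
isZeroP p = null (norm2 p)

-- The field F = ℚ(x,y): fractions num/den (den ≠ 0).

record RawF : Set where
  constructor _/_
  field
    num : Poly2
    den : Poly2
open RawF public

wfNZ : RawF → Bool
wfNZ f = not (isZeroP (den f)) ∧ not (isZeroP (num f))

wf : RawF → Bool
wf f = not (isZeroP (den f))

_≃F_ : RawF → RawF → Set
f ≃F g = norm2 (num f *P den g) ≡ norm2 (num g *P den f)

isZeroF : RawF → Bool
isZeroF f = isZeroP (num f)

zeroF oneF xF yF : RawF
zeroF = [] / ((1ℚ ∷ []) ∷ [])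
oneF  = ((1ℚ ∷ []) ∷ []) / ((1ℚ ∷ []) ∷ [])
xF    = ([] ∷ (1ℚ ∷ []) ∷ []) / ((1ℚ ∷ []) ∷ [])
yF    = ((0ℚ ∷ 1ℚ ∷ []) ∷ []) / ((1ℚ ∷ []) ∷ [])

_+F_ _-F_ _*F_ _÷F_ : RawF → RawF → RawF
(a / b) +F (c / d) = ((a *P d) +P (c *P b)) / (b *P d)
(a / b) -F (c / d) = ((a *P d) -P (c *P b)) / (b *P d)
(a / b) *F (c / d) = (a *P c) / (b *P d)
(a / b) ÷F (c / d) = (a *P d) / (b *P c)

infixl 6 _+F_ _-F_
infixl 7 _*F_ _÷F_

NZ : Set
NZ = Σ RawF (λ f → T (wfNZ f))

oneNZ : NZ
oneNZ = oneF , tt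

-- Packages an element of F known (mathematically) to be nonzero.  The
-- fallback branch is only reached for 0 or ill-formed fractions.
toNZ : RawF → NZ
toNZ f with wfNZ f in eq
... | true  = f , subst T (sym eq) tt
... | false = oneNZ

-- Symbol of I(a₀; a₁,…,aₙ; aₙ₊₁), valued in V^{⊗n}, represented by a
-- formal ℚ-linear combination of pure tensors a₁ ⊗ … ⊗ aₙ (aᵢ ∈ F^×).

Tensor : ℕ → Set
Tensor n = List (ℚ × Vec NZ n)

-- "zero factors omitted": a zero difference is replaced by 1
omit : RawF → RawF
omit f = if isZeroF f then oneF else f

𝒮 : ∀ {n} → RawF → Vec RawF n → RawF → Tensor n
𝒮 {zero}  a₀ []v      aₑ = (1ℚ , []v) ∷ []
𝒮 {suc n} a₀ as       aₑ = concatMap term (toList (allFin (suc n)))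
  where
  full : Vec RawF (suc (suc (suc n)))
  full = a₀ ∷ (as ∷ʳ aₑ)
  fac : Fin (suc n) → NZ
  fac i = toNZ (omit (lookup as i -F lookup full (fsuc (fsuc i)))
                ÷F omit (lookup as i -F lookup full (inject₁ (inject₁ i))))
  term : Fin (suc n) → Tensor (suc n)
  term i = map (λ { (c , t) → c , (t ∷ʳ fac i) }) (𝒮 a₀ (removeAt as i) aₑ)

𝒮I₃₁ : RawF → RawF → Tensor 4
𝒮I₃₁ u v = 𝒮 zeroF (u ∷ zeroF ∷ zeroF ∷ v ∷ []v) oneF

-- ∧²(∧²V), presented as the quotient of the free ℚ-vector space on
-- quadruples (a,b,c,d) ∈ (F^×)⁴ by: ℤ-multilinearity in each slot
-- (this yields V^{⊗4} = (F^×)^{⊗_ℤ 4} ⊗ ℚ), antisymmetry in (a,b),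
-- in (c,d), and under (a,b) ↔ (c,d).  The class of (a,b,c,d) is
-- (a∧b)∧(c∧d).

Gen : Set
Gen = Vec NZ 4

FS : Set
FS = List (ℚ × Gen)

_≃G_ : Gen → Gen → Set
g ≃G h = ∀ k → proj₁ (lookup g k) ≃F proj₁ (lookup h k)

infix 4 _∼_
data _∼_ : FS → FS → Set where
  ∼-refl  : ∀ {X} → X ∼ X
  ∼-sym   : ∀ {X Y} → X ∼ Y → Y ∼ X
  ∼-trans : ∀ {X Y Z} → X ∼ Y → Y ∼ Z → X ∼ Z
  ∼-++    : ∀ {X X' Y Y'} → X ∼ X' → Y ∼ Y' → X ++ Y ∼ X' ++ Y'
  ∼-comm  : ∀ X Y → X ++ Y ∼ Y ++ X
  ∼-merge : ∀ p q g → (p , g) ∷ (q , g) ∷ [] ∼ (p +q q , g) ∷ []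
  ∼-zero  : ∀ g → (0ℚ , g) ∷ [] ∼ []
  ∼-gen   : ∀ p g h → g ≃G h → (p , g) ∷ [] ∼ (p , h) ∷ []
  ∼-mult  : ∀ p g k (a b c : NZ) → proj₁ c ≃F (proj₁ a *F proj₁ b) →
            (p , g [ k ]≔ c) ∷ [] ∼ (p , g [ k ]≔ a) ∷ (p , g [ k ]≔ b) ∷ []
  ∼-alt₁₂ : ∀ p a b c d → (p , a ∷ b ∷ c ∷ d ∷ []v) ∷ [] ∼ (-q p , b ∷ a ∷ c ∷ d ∷ []v) ∷ []
  ∼-alt₃₄ : ∀ p a b c d → (p , a ∷ b ∷ c ∷ d ∷ []v) ∷ [] ∼ (-q p , a ∷ b ∷ d ∷ c ∷ []v) ∷ []
  ∼-altπ  : ∀ p a b c d → (p , a ∷ b ∷ c ∷ d ∷ []v) ∷ [] ∼ (-q p , c ∷ d ∷ a ∷ b ∷ []v) ∷ []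

-- π : V^{⊗4} → ∧²(∧²V), a⊗b⊗c⊗d ↦ (a∧b)∧(c∧d)
π : Tensor 4 → FS
π X = X

infix 4 _=δ_
_=δ_ : Tensor 4 → Tensor 4 → Set
X =δ Y = π X ∼ π Y

module Submission where

-- The six tensors 𝒮I₃₁(u,v) in the statement all have the same image in
-- ∧²(∧²V), namely the normal form  −(y−1 ∧ y) ∧ (x ∧ x−1);  each consecutive
-- pair is then related by going through this common value.
--
-- The equivalence  𝒮I₃₁(u,v) ∼ normal form  is a certified computation on
-- "factored" terms, whose four slots are words in the letters
-- ℓ₀ = y−1, ℓ₁ = y, ℓ₂ = x, ℓ₃ = x−y, ℓ₄ = x−1, their inverses and −1:
--   (1) the symbol is matched entrywise (up to equality in F) with a factored
--       combination S, supplied as data (S₁, …, S₆ below);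
--   (2) multiplicativity in each slot expands every term into ℚ-multiples of
--       quadruples of letters: −1 drops out (it is 2-torsion) and an inverse
--       letter contributes a sign;
--   (3) antisymmetry orients each term and discards degenerate ones, equal
--       terms are merged and zero coefficients removed.

open import Defs
open import Data.Bool using (Bool; true; false; T; _∧_; _∨_; if_then_else_)
open import Data.Bool.ListAction using (all)
open import Data.Bool.Properties using (T-∧)
open import Data.Fin using (Fin) renaming (zero to fzero; suc to fsuc)
open import Data.List using (List; []; _∷_; _++_; map; concatMap; allFin)
import Data.List.Properties as List
open import Data.Nat using (ℕ; _<ᵇ_; _≡ᵇ_)
import Data.Nat.Properties as ℕ
open import Data.Product using (_×_; _,_; proj₁; proj₂)
import Data.Product.Properties as Product
open import Data.Rational using (ℚ; 0ℚ; 1ℚ; ½) renaming (_+_ to _+q_; _*_ to _*q_; -_ to -q_)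
import Data.Rational.Properties as ℚ
open import Data.Unit using (tt)
open import Data.Vec using (Vec; _∷_; _[_]≔_; lookup; toList) renaming ([] to []v; map to mapV)
import Data.Vec.Properties as Vec
open import Function.Bundles using (Equivalence)
open import Relation.Nullary using (Dec; yes; no; does)
open import Relation.Nullary.Decidable using (map′)
open import Relation.Binary.PropositionalEquality
  using (_≡_; refl; sym; trans; cong; subst; subst₂)

split : ∀ {a b} → T (a ∧ b) → T a × T b
split = Equivalence.to T-∧

decided : ∀ {A : Set} (d : Dec A) → T (does d) → A
decided (yes a) _ = a
decided (no _)  ()

∷-cong : ∀ {t X Y} → X ∼ Y → t ∷ X ∼ t ∷ Y
∷-cong {t} X∼Y = ∼-++ {t ∷ []} {t ∷ []} ∼-refl X∼Y

negative-cancels : ∀ p g → (-q p , g) ∷ (p , g) ∷ [] ∼ []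
negative-cancels p g =
  ∼-trans (∼-merge (-q p) p g)
          (subst (λ r → (r , g) ∷ [] ∼ []) (sym (ℚ.+-inverseˡ p)) (∼-zero g))

twice-vanishes : ∀ {t} → t ∷ [] ∼ t ∷ t ∷ [] → t ∷ [] ∼ []
twice-vanishes {p , g} t∼2t =
  ∼-trans (∼-++ {[]} {(-q p , g) ∷ (p , g) ∷ []} (∼-sym (negative-cancels p g)) ∼-refl)
          (∼-trans (∷-cong (∼-sym t∼2t)) (negative-cancels p g))

-- Division by 2 in ℚ: if every doubled multiple of g vanishes, so does every
-- multiple of g.  This is how 2-torsion (from −1, from antisymmetry) is killed.
halves-vanish : ∀ {g} → (∀ q → (q , g) ∷ (q , g) ∷ [] ∼ []) → ∀ p → (p , g) ∷ [] ∼ []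
halves-vanish {g} doubled p =
  subst (λ r → (r , g) ∷ [] ∼ []) half+half
        (∼-trans (∼-sym (∼-merge (p *q ½) (p *q ½) g)) (doubled (p *q ½)))
  where
  half+half : p *q ½ +q p *q ½ ≡ p
  half+half = trans (sym (ℚ.*-distribˡ-+ p ½ ½)) (ℚ.*-identityʳ p)

self-negating-vanishes : ∀ {g} → (∀ q → (q , g) ∷ [] ∼ (-q q , g) ∷ []) →
                         ∀ p → (p , g) ∷ [] ∼ []
self-negating-vanishes {g} anti = halves-vanish λ q →
  ∼-trans (∷-cong (anti q))
  (∼-trans (∼-comm ((q , g) ∷ []) ((-q q , g) ∷ [])) (negative-cancels q g))

idempotent-slot-vanishes : ∀ p g k c → proj₁ c ≃F (proj₁ c *F proj₁ c) →
                           (p , g [ k ]≔ c) ∷ [] ∼ []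
idempotent-slot-vanishes p g k c c≃c² = twice-vanishes (∼-mult p g k c c c c≃c²)

_≟P_ : (a b : Poly2) → Dec (a ≡ b)
_≟P_ = List.≡-dec (List.≡-dec ℚ._≟_)

eqF? : RawF → RawF → Bool
eqF? f g = does (norm2 (num f *P den g) ≟P norm2 (num g *P den f))

eqF-sound : ∀ f g → T (eqF? f g) → f ≃F g
eqF-sound f g = decided (norm2 (num f *P den g) ≟P norm2 (num g *P den f))

eqV? : ∀ {n} → Vec NZ n → Vec NZ n → Bool
eqV? []v      []v      = true
eqV? (a ∷ g) (b ∷ h) = eqF? (proj₁ a) (proj₁ b) ∧ eqV? g h

eqV-sound : ∀ {n} (g h : Vec NZ n) → T (eqV? g h) →
            ∀ k → proj₁ (lookup g k) ≃F proj₁ (lookup h k)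
eqV-sound (a ∷ g) (b ∷ h) e fzero    = eqF-sound (proj₁ a) (proj₁ b) (proj₁ (split e))
eqV-sound (a ∷ g) (b ∷ h) e (fsuc k) = eqV-sound g h (proj₂ (split e)) k

-- Words in the alphabet.  A letter ℓᵢ is one of the five factors
-- y−1, y, x, x−y, x−1 (indices beyond 4 are never used).

letter : ℕ → RawF
letter 0 = yF -F oneF
letter 1 = yF
letter 2 = xF
letter 3 = xF -F yF
letter 4 = xF -F oneF
letter _ = xF

data Factor : Set where
  ℓ ℓ⁻¹ : ℕ → Factor
  minus : Factor

Word : Set
Word = List Factor

evalFactor : Factor → RawF
evalFactor (ℓ i)   = letter i
evalFactor (ℓ⁻¹ i) = oneF ÷F letter i
evalFactor minus   = zeroF -F oneF

evalWord : Word → RawF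
evalWord []          = oneF
evalWord (a ∷ [])    = evalFactor a
evalWord (a ∷ b ∷ w) = evalFactor a *F evalWord (b ∷ w)

⟦_⟧ : Word → NZ
⟦ w ⟧ = toNZ (evalWord w)

-- The letters of a factor, resp. a word, with the sign of their exponent
-- (true for +1, false for −1).
factorLetters : Factor → List (Bool × ℕ)
factorLetters (ℓ i)   = (true , i) ∷ []
factorLetters (ℓ⁻¹ i) = (false , i) ∷ []
factorLetters minus   = []

letters : Word → List (Bool × ℕ)
letters []      = []
letters (a ∷ w) = factorLetters a ++ letters w

signed : Bool → ℚ → ℚ
signed true  p = p
signed false p = -q p

-- The identities in F that justify expanding a factor, resp. a word:
-- ℓᵢ · ℓᵢ⁻¹ = 1, (−1)² = 1, and that ⟦_⟧ turns concatenation into products.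
factorOK : Factor → Bool
factorOK (ℓ i)   = true
factorOK (ℓ⁻¹ i) = eqF? oneF (proj₁ ⟦ ℓ i ∷ [] ⟧ *F proj₁ ⟦ ℓ⁻¹ i ∷ [] ⟧)
factorOK minus   = eqF? oneF (proj₁ ⟦ minus ∷ [] ⟧ *F proj₁ ⟦ minus ∷ [] ⟧)

wordOK : Word → Bool
wordOK []          = true
wordOK (a ∷ [])    = factorOK a
wordOK (a ∷ b ∷ w) = eqF? (proj₁ ⟦ a ∷ b ∷ w ⟧) (proj₁ ⟦ a ∷ [] ⟧ *F proj₁ ⟦ b ∷ w ⟧)
                     ∧ (factorOK a ∧ wordOK (b ∷ w))

letterTerm : ℚ → Gen → Fin 4 → Bool × ℕ → ℚ × Gen
letterTerm p g k (e , i) = signed e p , g [ k ]≔ ⟦ ℓ i ∷ [] ⟧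

unit-slot-vanishes : ∀ p g k → (p , g [ k ]≔ ⟦ [] ⟧) ∷ [] ∼ []
unit-slot-vanishes p g k = idempotent-slot-vanishes p g k ⟦ [] ⟧
  (eqF-sound (proj₁ ⟦ [] ⟧) (proj₁ ⟦ [] ⟧ *F proj₁ ⟦ [] ⟧) tt)

expand-factor : ∀ p g k a → T (factorOK a) →
                (p , g [ k ]≔ ⟦ a ∷ [] ⟧) ∷ [] ∼ map (letterTerm p g k) (factorLetters a)
expand-factor p g k (ℓ i) _ = ∼-refl
expand-factor p g k (ℓ⁻¹ i) inverse =
  ∼-trans (∼-++ {[]} {(-q p , g [ k ]≔ b) ∷ (p , g [ k ]≔ b) ∷ []}
                (∼-sym (negative-cancels p _)) ∼-refl)
          (∷-cong (∼-trans (∼-sym (∼-mult p g k b b⁻¹ ⟦ [] ⟧ (eqF-sound oneF (proj₁ b *F proj₁ b⁻¹) inverse)))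
                           (unit-slot-vanishes p g k)))
  where
  b b⁻¹ : NZ
  b   = ⟦ ℓ i ∷ [] ⟧
  b⁻¹ = ⟦ ℓ⁻¹ i ∷ [] ⟧
expand-factor p g k minus square = halves-vanish
  (λ q → ∼-trans (∼-sym (∼-mult q g k m m ⟦ [] ⟧ (eqF-sound oneF (proj₁ m *F proj₁ m) square)))
                 (unit-slot-vanishes q g k)) p
  where
  m : NZ
  m = ⟦ minus ∷ [] ⟧

expand-word : ∀ p g k w → T (wordOK w) →
              (p , g [ k ]≔ ⟦ w ⟧) ∷ [] ∼ map (letterTerm p g k) (letters w)
expand-word p g k []       _  = unit-slot-vanishes p g k
expand-word p g k (a ∷ []) ok =
  subst (λ ls → (p , g [ k ]≔ ⟦ a ∷ [] ⟧) ∷ [] ∼ map (letterTerm p g k) ls) (sym (List.++-identityʳ (factorLetters a)))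
        (expand-factor p g k a ok)
expand-word p g k (a ∷ b ∷ w) ok =
  ∼-trans (∼-mult p g k ⟦ a ∷ [] ⟧ ⟦ b ∷ w ⟧ ⟦ a ∷ b ∷ w ⟧
            (eqF-sound (proj₁ ⟦ a ∷ b ∷ w ⟧) (proj₁ ⟦ a ∷ [] ⟧ *F proj₁ ⟦ b ∷ w ⟧) (proj₁ checks)))
          (subst (λ X → (p , g [ k ]≔ ⟦ a ∷ [] ⟧) ∷ (p , g [ k ]≔ ⟦ b ∷ w ⟧) ∷ [] ∼ X)
                 (sym (List.map-++ (letterTerm p g k) (factorLetters a) (letters (b ∷ w))))
                 (∼-++ {(p , g [ k ]≔ ⟦ a ∷ [] ⟧) ∷ []}
                       (expand-factor p g k a (proj₁ rest)) (expand-word p g k (b ∷ w) (proj₂ rest))))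
  where
  checks : T (eqF? (proj₁ ⟦ a ∷ b ∷ w ⟧) (proj₁ ⟦ a ∷ [] ⟧ *F proj₁ ⟦ b ∷ w ⟧))
           × T (factorOK a ∧ wordOK (b ∷ w))
  checks = split ok
  rest : T (factorOK a) × T (wordOK (b ∷ w))
  rest = split (proj₂ checks)

FactoredTerm : Set
FactoredTerm = ℚ × Vec Word 4

tensor : Word → Word → Word → Word → FactoredTerm
tensor a b c d = 1ℚ , a ∷ b ∷ c ∷ d ∷ []v

⟦_⟧ᵗ : FactoredTerm → ℚ × Gen
⟦ p , s ⟧ᵗ = p , mapV ⟦_⟧ s

⟦_⟧ˡ : List FactoredTerm → FS
⟦ L ⟧ˡ = map ⟦_⟧ᵗ L

concatMap-sound : (f : FactoredTerm → List FactoredTerm) (ok : FactoredTerm → Bool) →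
                  (∀ t → T (ok t) → ⟦ t ⟧ᵗ ∷ [] ∼ ⟦ f t ⟧ˡ) →
                  ∀ L → T (all ok L) → ⟦ L ⟧ˡ ∼ ⟦ concatMap f L ⟧ˡ
concatMap-sound f ok sound []      _   = ∼-refl
concatMap-sound f ok sound (t ∷ L) oks =
  subst (λ X → ⟦ t ∷ L ⟧ˡ ∼ X) (sym (List.map-++ ⟦_⟧ᵗ (f t) (concatMap f L)))
        (∼-++ {⟦ t ⟧ᵗ ∷ []} (sound t (proj₁ (split oks)))
                            (concatMap-sound f ok sound L (proj₂ (split oks))))

concatMap-sound′ : (f : FactoredTerm → List FactoredTerm) →
                   (∀ t → ⟦ t ⟧ᵗ ∷ [] ∼ ⟦ f t ⟧ˡ) →
                   ∀ L → ⟦ L ⟧ˡ ∼ ⟦ concatMap f L ⟧ˡ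
concatMap-sound′ f sound L = concatMap-sound f (λ _ → true) (λ t _ → sound t) L (trivially L)
  where
  trivially : ∀ L → T (all (λ _ → true) L)
  trivially []      = tt
  trivially (_ ∷ L) = trivially L

slotOK : Fin 4 → FactoredTerm → Bool
slotOK k (p , s) = wordOK (lookup s k)

expandSlot : Fin 4 → FactoredTerm → List FactoredTerm
expandSlot k (p , s) = map (λ { (e , i) → signed e p , s [ k ]≔ (ℓ i ∷ []) }) (letters (lookup s k))

expandSlot-sound : ∀ k t → T (slotOK k t) → ⟦ t ⟧ᵗ ∷ [] ∼ ⟦ expandSlot k t ⟧ˡ
expandSlot-sound k (p , s) ok =
  subst₂ _∼_ (cong (λ g → (p , g) ∷ []) refill) interpret
         (expand-word p (mapV ⟦_⟧ s) k (lookup s k) ok)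
  where
  g : Gen
  g = mapV ⟦_⟧ s
  refill : g [ k ]≔ ⟦ lookup s k ⟧ ≡ g
  refill = trans (cong (g [ k ]≔_) (sym (Vec.lookup-map k ⟦_⟧ s))) (Vec.[]≔-lookup g k)
  interpret : map (letterTerm p g k) (letters (lookup s k)) ≡ ⟦ expandSlot k (p , s) ⟧ˡ
  interpret = trans (List.map-cong (λ { (e , i) → cong (signed e p ,_) (sym (Vec.map-[]≔ ⟦_⟧ s k)) })
                                   (letters (lookup s k)))
                    (List.map-∘ (letters (lookup s k)))

expandSlots : List (Fin 4) → List FactoredTerm → List FactoredTerm
expandSlots []       L = L
expandSlots (k ∷ ks) L = expandSlots ks (concatMap (expandSlot k) L)

expandable : List (Fin 4) → List FactoredTerm → Bool
expandable []       L = true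
expandable (k ∷ ks) L = all (slotOK k) L ∧ expandable ks (concatMap (expandSlot k) L)

expandSlots-sound : ∀ ks L → T (expandable ks L) → ⟦ L ⟧ˡ ∼ ⟦ expandSlots ks L ⟧ˡ
expandSlots-sound []       L _  = ∼-refl
expandSlots-sound (k ∷ ks) L ok =
  ∼-trans (concatMap-sound (expandSlot k) (slotOK k) (expandSlot-sound k) L (proj₁ (split ok)))
          (expandSlots-sound ks (concatMap (expandSlot k) L) (proj₂ (split ok)))

_≟ᶠ_ : (a b : Factor) → Dec (a ≡ b)
ℓ i   ≟ᶠ ℓ j   = map′ (cong ℓ) (λ { refl → refl }) (i ℕ.≟ j)
ℓ⁻¹ i ≟ᶠ ℓ⁻¹ j = map′ (cong ℓ⁻¹) (λ { refl → refl }) (i ℕ.≟ j)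
minus ≟ᶠ minus = yes refl
ℓ _   ≟ᶠ ℓ⁻¹ _ = no (λ ())
ℓ _   ≟ᶠ minus = no (λ ())
ℓ⁻¹ _ ≟ᶠ ℓ _   = no (λ ())
ℓ⁻¹ _ ≟ᶠ minus = no (λ ())
minus ≟ᶠ ℓ _   = no (λ ())
minus ≟ᶠ ℓ⁻¹ _ = no (λ ())

Slots : Set
Slots = Vec Word 4

_≟ˢ_ : (s t : Slots) → Dec (s ≡ t)
_≟ˢ_ = Vec.≡-dec (List.≡-dec _≟ᶠ_)

_≟ˡ_ : (L M : List FactoredTerm) → Dec (L ≡ M)
_≟ˡ_ = List.≡-dec (Product.≡-dec ℚ._≟_ _≟ˢ_)

-- Orientation by antisymmetry.  σ is a permutation of the slots that
-- reverses the sign of every generator; a σ-fixed term then vanishes, and an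
-- out-of-order term is replaced by the negative of its σ-image.

SignReversing : (Slots → Slots) → Set
SignReversing σ = ∀ p s → ⟦ p , s ⟧ᵗ ∷ [] ∼ ⟦ -q p , σ s ⟧ᵗ ∷ []

orient : (Slots → Slots) → (Slots → Bool) → FactoredTerm → List FactoredTerm
orient σ outOfOrder (p , s) with σ s ≟ˢ s
... | yes _ = []
... | no _  = if outOfOrder s then (-q p , σ s) ∷ [] else (p , s) ∷ []

orient-sound : ∀ σ → SignReversing σ → ∀ outOfOrder t → ⟦ t ⟧ᵗ ∷ [] ∼ ⟦ orient σ outOfOrder t ⟧ˡ
orient-sound σ reverses outOfOrder (p , s) with σ s ≟ˢ s
... | yes fixed = self-negating-vanishes (λ q →
        subst (λ s′ → ⟦ q , s ⟧ᵗ ∷ [] ∼ ⟦ -q q , s′ ⟧ᵗ ∷ []) fixed (reverses q s)) p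
... | no _ with outOfOrder s
...   | true  = reverses p s
...   | false = ∼-refl

swap₁₂ swap₃₄ swapπ : Slots → Slots
swap₁₂ (a ∷ b ∷ c ∷ d ∷ []v) = b ∷ a ∷ c ∷ d ∷ []v
swap₃₄ (a ∷ b ∷ c ∷ d ∷ []v) = a ∷ b ∷ d ∷ c ∷ []v
swapπ  (a ∷ b ∷ c ∷ d ∷ []v) = c ∷ d ∷ a ∷ b ∷ []v

swap₁₂-reverses : SignReversing swap₁₂
swap₁₂-reverses p (a ∷ b ∷ c ∷ d ∷ []v) = ∼-alt₁₂ p ⟦ a ⟧ ⟦ b ⟧ ⟦ c ⟧ ⟦ d ⟧

swap₃₄-reverses : SignReversing swap₃₄
swap₃₄-reverses p (a ∷ b ∷ c ∷ d ∷ []v) = ∼-alt₃₄ p ⟦ a ⟧ ⟦ b ⟧ ⟦ c ⟧ ⟦ d ⟧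

swapπ-reverses : SignReversing swapπ
swapπ-reverses p (a ∷ b ∷ c ∷ d ∷ []v) = ∼-altπ p ⟦ a ⟧ ⟦ b ⟧ ⟦ c ⟧ ⟦ d ⟧

-- The order used for orienting and sorting: lexicographic on the indices of
-- the letters (after expansion every slot holds a single letter).

index : Word → ℕ
index (ℓ i ∷ []) = i
index _          = 0

lexLess : List ℕ → List ℕ → Bool
lexLess (m ∷ ms) (n ∷ ns) = (m <ᵇ n) ∨ ((m ≡ᵇ n) ∧ lexLess ms ns)
lexLess _        _        = false

_<ˢ_ : Slots → Slots → Bool
s <ˢ t = lexLess (map index (toList s)) (map index (toList t))

descending₁₂ descending₃₄ descendingπ : Slots → Bool
descending₁₂ (a ∷ b ∷ c ∷ d ∷ []v) = index b <ᵇ index a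
descending₃₄ (a ∷ b ∷ c ∷ d ∷ []v) = index d <ᵇ index c
descendingπ  (a ∷ b ∷ c ∷ d ∷ []v) = lexLess (index c ∷ index d ∷ []) (index a ∷ index b ∷ [])

orientAll : List FactoredTerm → List FactoredTerm
orientAll L = concatMap (orient swapπ descendingπ)
                (concatMap (orient swap₃₄ descending₃₄)
                  (concatMap (orient swap₁₂ descending₁₂) L))

orientAll-sound : ∀ L → ⟦ L ⟧ˡ ∼ ⟦ orientAll L ⟧ˡ
orientAll-sound L =
  ∼-trans (concatMap-sound′ _ (orient-sound swap₁₂ swap₁₂-reverses descending₁₂) L)
  (∼-trans (concatMap-sound′ _ (orient-sound swap₃₄ swap₃₄-reverses descending₃₄) L₁₂)
           (concatMap-sound′ _ (orient-sound swapπ swapπ-reverses descendingπ) L₃₄))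
  where
  L₁₂ L₃₄ : List FactoredTerm
  L₁₂ = concatMap (orient swap₁₂ descending₁₂) L
  L₃₄ = concatMap (orient swap₃₄ descending₃₄) L₁₂

insertMerge : FactoredTerm → List FactoredTerm → List FactoredTerm
insertMerge t [] = t ∷ []
insertMerge (p , s) ((q , s′) ∷ L) with s ≟ˢ s′
... | yes _ = (p +q q , s′) ∷ L
... | no _  = if s <ˢ s′ then (p , s) ∷ (q , s′) ∷ L else (q , s′) ∷ insertMerge (p , s) L

insertMerge-sound : ∀ t L → ⟦ t ∷ L ⟧ˡ ∼ ⟦ insertMerge t L ⟧ˡ
insertMerge-sound t [] = ∼-refl
insertMerge-sound (p , s) ((q , s′) ∷ L) with s ≟ˢ s′
... | yes refl = ∼-++ {⟦ p , s ⟧ᵗ ∷ ⟦ q , s ⟧ᵗ ∷ []} (∼-merge p q (mapV ⟦_⟧ s)) ∼-refl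
... | no _ with s <ˢ s′
...   | true  = ∼-refl
...   | false =
  ∼-trans (∼-++ {⟦ p , s ⟧ᵗ ∷ ⟦ q , s′ ⟧ᵗ ∷ []} (∼-comm (⟦ p , s ⟧ᵗ ∷ []) (⟦ q , s′ ⟧ᵗ ∷ [])) ∼-refl)
          (∷-cong (insertMerge-sound (p , s) L))

sortMerge : List FactoredTerm → List FactoredTerm
sortMerge []      = []
sortMerge (t ∷ L) = insertMerge t (sortMerge L)

sortMerge-sound : ∀ L → ⟦ L ⟧ˡ ∼ ⟦ sortMerge L ⟧ˡ
sortMerge-sound []      = ∼-refl
sortMerge-sound (t ∷ L) = ∼-trans (∷-cong (sortMerge-sound L)) (insertMerge-sound t (sortMerge L))

dropZeros : List FactoredTerm → List FactoredTerm
dropZeros [] = []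
dropZeros ((p , s) ∷ L) with p ℚ.≟ 0ℚ
... | yes _ = dropZeros L
... | no _  = (p , s) ∷ dropZeros L

dropZeros-sound : ∀ L → ⟦ L ⟧ˡ ∼ ⟦ dropZeros L ⟧ˡ
dropZeros-sound [] = ∼-refl
dropZeros-sound ((p , s) ∷ L) with p ℚ.≟ 0ℚ
... | yes refl = ∼-++ {⟦ 0ℚ , s ⟧ᵗ ∷ []} {[]} (∼-zero _) (dropZeros-sound L)
... | no _     = ∷-cong (dropZeros-sound L)

normalise : List FactoredTerm → List FactoredTerm
normalise S = dropZeros (sortMerge (orientAll (expandSlots (allFin 4) S)))

normalise-sound : ∀ S → T (expandable (allFin 4) S) → ⟦ S ⟧ˡ ∼ ⟦ normalise S ⟧ˡ
normalise-sound S ok =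
  ∼-trans (expandSlots-sound (allFin 4) S ok)
  (∼-trans (orientAll-sound expanded)
  (∼-trans (sortMerge-sound (orientAll expanded))
           (dropZeros-sound (sortMerge (orientAll expanded)))))
  where
  expanded : List FactoredTerm
  expanded = expandSlots (allFin 4) S

matches : FS → List FactoredTerm → Bool
matches []            []            = true
matches ((q , g) ∷ X) ((p , s) ∷ S) = does (q ℚ.≟ p) ∧ (eqV? g (mapV ⟦_⟧ s) ∧ matches X S)
matches _             _             = false

matches-sound : ∀ X S → T (matches X S) → X ∼ ⟦ S ⟧ˡ
matches-sound []            []            _ = ∼-refl
matches-sound ((q , g) ∷ X) ((p , s) ∷ S) m =
  ∼-++ {(q , g) ∷ []}
       (subst (λ r → (q , g) ∷ [] ∼ (r , mapV ⟦_⟧ s) ∷ []) (decided (q ℚ.≟ p) (proj₁ checks))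
              (∼-gen q g (mapV ⟦_⟧ s) (eqV-sound g (mapV ⟦_⟧ s) (proj₁ rest))))
       (matches-sound X S (proj₂ rest))
  where
  checks : T (does (q ℚ.≟ p)) × T (eqV? g (mapV ⟦_⟧ s) ∧ matches X S)
  checks = split m
  rest : T (eqV? g (mapV ⟦_⟧ s)) × T (matches X S)
  rest = split (proj₂ checks)

certified : ∀ X S NF →
            T (matches X S ∧ (expandable (allFin 4) S ∧ does (normalise S ≟ˡ NF))) →
            X ∼ ⟦ NF ⟧ˡ
certified X S NF ok =
  subst (λ N → X ∼ ⟦ N ⟧ˡ) (decided (normalise S ≟ˡ NF) (proj₂ rest))
        (∼-trans (matches-sound X S (proj₁ checks)) (normalise-sound S (proj₁ rest)))
  where
  checks : T (matches X S) × T (expandable (allFin 4) S ∧ does (normalise S ≟ˡ NF))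
  checks = split ok
  rest : T (expandable (allFin 4) S) × T (does (normalise S ≟ˡ NF))
  rest = split (proj₂ checks)

via-normal-form : ∀ {X Y N} → X ∼ N → Y ∼ N → X =δ Y
via-normal-form X∼N Y∼N = ∼-trans X∼N (∼-sym Y∼N)

normalForm : List FactoredTerm
normalForm = (-q 1ℚ , (ℓ 0 ∷ []) ∷ (ℓ 1 ∷ []) ∷ (ℓ 2 ∷ []) ∷ (ℓ 4 ∷ []) ∷ []v) ∷ []

-- Factorisations of the 24 terms of each symbol 𝒮I₃₁(u,v), in the order in
-- which 𝒮 produces them, for (u,v) = (x,y), (1−x,1−y), (1/x,1/y),
-- (1/(1−x),1/(1−y)), (1−1/x,1−1/y) and (x/(x−1),y/(y−1)) respectively.

S₁ : List FactoredTerm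
S₁ =
  ( tensor (ℓ 0 ∷ ℓ⁻¹ 1 ∷ []) (minus ∷ ℓ 1 ∷ []) [] []
  ∷ tensor (minus ∷ []) (ℓ 0 ∷ ℓ⁻¹ 1 ∷ []) [] []
  ∷ tensor (ℓ 0 ∷ ℓ⁻¹ 1 ∷ []) (minus ∷ ℓ 1 ∷ []) (minus ∷ ℓ 1 ∷ []) []
  ∷ tensor (minus ∷ []) (ℓ 0 ∷ ℓ⁻¹ 1 ∷ []) (minus ∷ ℓ 1 ∷ []) []
  ∷ tensor (minus ∷ []) [] (ℓ 0 ∷ ℓ⁻¹ 1 ∷ []) []
  ∷ tensor (minus ∷ []) (minus ∷ []) (ℓ 0 ∷ ℓ⁻¹ 1 ∷ []) []
  ∷ tensor (ℓ 0 ∷ ℓ⁻¹ 1 ∷ []) (minus ∷ ℓ 1 ∷ []) [] (minus ∷ ℓ⁻¹ 2 ∷ [])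
  ∷ tensor (minus ∷ []) (ℓ 0 ∷ ℓ⁻¹ 1 ∷ []) [] (minus ∷ ℓ⁻¹ 2 ∷ [])
  ∷ tensor (ℓ 0 ∷ ℓ⁻¹ 1 ∷ []) (ℓ⁻¹ 2 ∷ ℓ 3 ∷ []) (ℓ 1 ∷ ℓ⁻¹ 2 ∷ []) (minus ∷ ℓ⁻¹ 2 ∷ [])
  ∷ tensor (ℓ⁻¹ 2 ∷ ℓ 4 ∷ []) (minus ∷ ℓ 0 ∷ ℓ⁻¹ 3 ∷ []) (ℓ 1 ∷ ℓ⁻¹ 2 ∷ []) (minus ∷ ℓ⁻¹ 2 ∷ [])
  ∷ tensor (minus ∷ []) [] (ℓ 0 ∷ ℓ⁻¹ 1 ∷ []) (minus ∷ ℓ⁻¹ 2 ∷ [])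
  ∷ tensor (ℓ⁻¹ 2 ∷ ℓ 4 ∷ []) (ℓ⁻¹ 2 ∷ []) (ℓ 0 ∷ ℓ⁻¹ 1 ∷ []) (minus ∷ ℓ⁻¹ 2 ∷ [])
  ∷ tensor (ℓ 0 ∷ ℓ⁻¹ 1 ∷ []) (minus ∷ ℓ 1 ∷ []) [] (minus ∷ ℓ 1 ∷ [])
  ∷ tensor (minus ∷ []) (ℓ 0 ∷ ℓ⁻¹ 1 ∷ []) [] (minus ∷ ℓ 1 ∷ [])
  ∷ tensor (ℓ 0 ∷ ℓ⁻¹ 1 ∷ []) (ℓ⁻¹ 2 ∷ ℓ 3 ∷ []) (ℓ 1 ∷ ℓ⁻¹ 2 ∷ []) (minus ∷ ℓ 1 ∷ [])
  ∷ tensor (ℓ⁻¹ 2 ∷ ℓ 4 ∷ []) (minus ∷ ℓ 0 ∷ ℓ⁻¹ 3 ∷ []) (ℓ 1 ∷ ℓ⁻¹ 2 ∷ []) (minus ∷ ℓ 1 ∷ [])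
  ∷ tensor (minus ∷ []) [] (ℓ 0 ∷ ℓ⁻¹ 1 ∷ []) (minus ∷ ℓ 1 ∷ [])
  ∷ tensor (ℓ⁻¹ 2 ∷ ℓ 4 ∷ []) (ℓ⁻¹ 2 ∷ []) (ℓ 0 ∷ ℓ⁻¹ 1 ∷ []) (minus ∷ ℓ 1 ∷ [])
  ∷ tensor (minus ∷ []) [] [] (ℓ 0 ∷ ℓ⁻¹ 1 ∷ [])
  ∷ tensor (minus ∷ []) (minus ∷ []) [] (ℓ 0 ∷ ℓ⁻¹ 1 ∷ [])
  ∷ tensor (minus ∷ []) [] (minus ∷ ℓ⁻¹ 2 ∷ []) (ℓ 0 ∷ ℓ⁻¹ 1 ∷ [])
  ∷ tensor (ℓ⁻¹ 2 ∷ ℓ 4 ∷ []) (ℓ⁻¹ 2 ∷ []) (minus ∷ ℓ⁻¹ 2 ∷ []) (ℓ 0 ∷ ℓ⁻¹ 1 ∷ [])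
  ∷ tensor (minus ∷ []) [] (minus ∷ []) (ℓ 0 ∷ ℓ⁻¹ 1 ∷ [])
  ∷ tensor (ℓ⁻¹ 2 ∷ ℓ 4 ∷ []) (ℓ⁻¹ 2 ∷ []) (minus ∷ []) (ℓ 0 ∷ ℓ⁻¹ 1 ∷ [])
  ∷ [])

S₂ : List FactoredTerm
S₂ =
  ( tensor (ℓ⁻¹ 0 ∷ ℓ 1 ∷ []) (ℓ 0 ∷ []) [] []
  ∷ tensor (minus ∷ []) (ℓ⁻¹ 0 ∷ ℓ 1 ∷ []) [] []
  ∷ tensor (ℓ⁻¹ 0 ∷ ℓ 1 ∷ []) (ℓ 0 ∷ []) (ℓ 0 ∷ []) []
  ∷ tensor (minus ∷ []) (ℓ⁻¹ 0 ∷ ℓ 1 ∷ []) (ℓ 0 ∷ []) []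
  ∷ tensor (minus ∷ []) [] (ℓ⁻¹ 0 ∷ ℓ 1 ∷ []) []
  ∷ tensor (minus ∷ []) (minus ∷ []) (ℓ⁻¹ 0 ∷ ℓ 1 ∷ []) []
  ∷ tensor (ℓ⁻¹ 0 ∷ ℓ 1 ∷ []) (ℓ 0 ∷ []) [] (ℓ⁻¹ 4 ∷ [])
  ∷ tensor (minus ∷ []) (ℓ⁻¹ 0 ∷ ℓ 1 ∷ []) [] (ℓ⁻¹ 4 ∷ [])
  ∷ tensor (ℓ⁻¹ 0 ∷ ℓ 1 ∷ []) (ℓ 3 ∷ ℓ⁻¹ 4 ∷ []) (ℓ 0 ∷ ℓ⁻¹ 4 ∷ []) (ℓ⁻¹ 4 ∷ [])
  ∷ tensor (ℓ 2 ∷ ℓ⁻¹ 4 ∷ []) (minus ∷ ℓ 1 ∷ ℓ⁻¹ 3 ∷ []) (ℓ 0 ∷ ℓ⁻¹ 4 ∷ []) (ℓ⁻¹ 4 ∷ [])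
  ∷ tensor (minus ∷ []) [] (ℓ⁻¹ 0 ∷ ℓ 1 ∷ []) (ℓ⁻¹ 4 ∷ [])
  ∷ tensor (ℓ 2 ∷ ℓ⁻¹ 4 ∷ []) (minus ∷ ℓ⁻¹ 4 ∷ []) (ℓ⁻¹ 0 ∷ ℓ 1 ∷ []) (ℓ⁻¹ 4 ∷ [])
  ∷ tensor (ℓ⁻¹ 0 ∷ ℓ 1 ∷ []) (ℓ 0 ∷ []) [] (ℓ 0 ∷ [])
  ∷ tensor (minus ∷ []) (ℓ⁻¹ 0 ∷ ℓ 1 ∷ []) [] (ℓ 0 ∷ [])
  ∷ tensor (ℓ⁻¹ 0 ∷ ℓ 1 ∷ []) (ℓ 3 ∷ ℓ⁻¹ 4 ∷ []) (ℓ 0 ∷ ℓ⁻¹ 4 ∷ []) (ℓ 0 ∷ [])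
  ∷ tensor (ℓ 2 ∷ ℓ⁻¹ 4 ∷ []) (minus ∷ ℓ 1 ∷ ℓ⁻¹ 3 ∷ []) (ℓ 0 ∷ ℓ⁻¹ 4 ∷ []) (ℓ 0 ∷ [])
  ∷ tensor (minus ∷ []) [] (ℓ⁻¹ 0 ∷ ℓ 1 ∷ []) (ℓ 0 ∷ [])
  ∷ tensor (ℓ 2 ∷ ℓ⁻¹ 4 ∷ []) (minus ∷ ℓ⁻¹ 4 ∷ []) (ℓ⁻¹ 0 ∷ ℓ 1 ∷ []) (ℓ 0 ∷ [])
  ∷ tensor (minus ∷ []) [] [] (ℓ⁻¹ 0 ∷ ℓ 1 ∷ [])
  ∷ tensor (minus ∷ []) (minus ∷ []) [] (ℓ⁻¹ 0 ∷ ℓ 1 ∷ [])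
  ∷ tensor (minus ∷ []) [] (ℓ⁻¹ 4 ∷ []) (ℓ⁻¹ 0 ∷ ℓ 1 ∷ [])
  ∷ tensor (ℓ 2 ∷ ℓ⁻¹ 4 ∷ []) (minus ∷ ℓ⁻¹ 4 ∷ []) (ℓ⁻¹ 4 ∷ []) (ℓ⁻¹ 0 ∷ ℓ 1 ∷ [])
  ∷ tensor (minus ∷ []) [] (minus ∷ []) (ℓ⁻¹ 0 ∷ ℓ 1 ∷ [])
  ∷ tensor (ℓ 2 ∷ ℓ⁻¹ 4 ∷ []) (minus ∷ ℓ⁻¹ 4 ∷ []) (minus ∷ []) (ℓ⁻¹ 0 ∷ ℓ 1 ∷ [])
  ∷ [])

S₃ : List FactoredTerm
S₃ =
  ( tensor (minus ∷ ℓ 0 ∷ []) (minus ∷ ℓ⁻¹ 1 ∷ []) [] []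
  ∷ tensor (minus ∷ []) (minus ∷ ℓ 0 ∷ []) [] []
  ∷ tensor (minus ∷ ℓ 0 ∷ []) (minus ∷ ℓ⁻¹ 1 ∷ []) (minus ∷ ℓ⁻¹ 1 ∷ []) []
  ∷ tensor (minus ∷ []) (minus ∷ ℓ 0 ∷ []) (minus ∷ ℓ⁻¹ 1 ∷ []) []
  ∷ tensor (minus ∷ []) [] (minus ∷ ℓ 0 ∷ []) []
  ∷ tensor (minus ∷ []) (minus ∷ []) (minus ∷ ℓ 0 ∷ []) []
  ∷ tensor (minus ∷ ℓ 0 ∷ []) (minus ∷ ℓ⁻¹ 1 ∷ []) [] (minus ∷ ℓ 2 ∷ [])
  ∷ tensor (minus ∷ []) (minus ∷ ℓ 0 ∷ []) [] (minus ∷ ℓ 2 ∷ [])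
  ∷ tensor (minus ∷ ℓ 0 ∷ []) (minus ∷ ℓ⁻¹ 1 ∷ ℓ 3 ∷ []) (ℓ⁻¹ 1 ∷ ℓ 2 ∷ []) (minus ∷ ℓ 2 ∷ [])
  ∷ tensor (minus ∷ ℓ 4 ∷ []) (minus ∷ ℓ 0 ∷ ℓ 2 ∷ ℓ⁻¹ 3 ∷ []) (ℓ⁻¹ 1 ∷ ℓ 2 ∷ []) (minus ∷ ℓ 2 ∷ [])
  ∷ tensor (minus ∷ []) [] (minus ∷ ℓ 0 ∷ []) (minus ∷ ℓ 2 ∷ [])
  ∷ tensor (minus ∷ ℓ 4 ∷ []) (ℓ 2 ∷ []) (minus ∷ ℓ 0 ∷ []) (minus ∷ ℓ 2 ∷ [])
  ∷ tensor (minus ∷ ℓ 0 ∷ []) (minus ∷ ℓ⁻¹ 1 ∷ []) [] (minus ∷ ℓ⁻¹ 1 ∷ [])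
  ∷ tensor (minus ∷ []) (minus ∷ ℓ 0 ∷ []) [] (minus ∷ ℓ⁻¹ 1 ∷ [])
  ∷ tensor (minus ∷ ℓ 0 ∷ []) (minus ∷ ℓ⁻¹ 1 ∷ ℓ 3 ∷ []) (ℓ⁻¹ 1 ∷ ℓ 2 ∷ []) (minus ∷ ℓ⁻¹ 1 ∷ [])
  ∷ tensor (minus ∷ ℓ 4 ∷ []) (minus ∷ ℓ 0 ∷ ℓ 2 ∷ ℓ⁻¹ 3 ∷ []) (ℓ⁻¹ 1 ∷ ℓ 2 ∷ []) (minus ∷ ℓ⁻¹ 1 ∷ [])
  ∷ tensor (minus ∷ []) [] (minus ∷ ℓ 0 ∷ []) (minus ∷ ℓ⁻¹ 1 ∷ [])
  ∷ tensor (minus ∷ ℓ 4 ∷ []) (ℓ 2 ∷ []) (minus ∷ ℓ 0 ∷ []) (minus ∷ ℓ⁻¹ 1 ∷ [])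
  ∷ tensor (minus ∷ []) [] [] (minus ∷ ℓ 0 ∷ [])
  ∷ tensor (minus ∷ []) (minus ∷ []) [] (minus ∷ ℓ 0 ∷ [])
  ∷ tensor (minus ∷ []) [] (minus ∷ ℓ 2 ∷ []) (minus ∷ ℓ 0 ∷ [])
  ∷ tensor (minus ∷ ℓ 4 ∷ []) (ℓ 2 ∷ []) (minus ∷ ℓ 2 ∷ []) (minus ∷ ℓ 0 ∷ [])
  ∷ tensor (minus ∷ []) [] (minus ∷ []) (minus ∷ ℓ 0 ∷ [])
  ∷ tensor (minus ∷ ℓ 4 ∷ []) (ℓ 2 ∷ []) (minus ∷ []) (minus ∷ ℓ 0 ∷ [])
  ∷ [])

S₄ : List FactoredTerm
S₄ =
  ( tensor (ℓ 1 ∷ []) (ℓ⁻¹ 0 ∷ []) [] []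
  ∷ tensor (minus ∷ []) (ℓ 1 ∷ []) [] []
  ∷ tensor (ℓ 1 ∷ []) (ℓ⁻¹ 0 ∷ []) (ℓ⁻¹ 0 ∷ []) []
  ∷ tensor (minus ∷ []) (ℓ 1 ∷ []) (ℓ⁻¹ 0 ∷ []) []
  ∷ tensor (minus ∷ []) [] (ℓ 1 ∷ []) []
  ∷ tensor (minus ∷ []) (minus ∷ []) (ℓ 1 ∷ []) []
  ∷ tensor (ℓ 1 ∷ []) (ℓ⁻¹ 0 ∷ []) [] (ℓ 4 ∷ [])
  ∷ tensor (minus ∷ []) (ℓ 1 ∷ []) [] (ℓ 4 ∷ [])
  ∷ tensor (ℓ 1 ∷ []) (minus ∷ ℓ⁻¹ 0 ∷ ℓ 3 ∷ []) (ℓ⁻¹ 0 ∷ ℓ 4 ∷ []) (ℓ 4 ∷ [])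
  ∷ tensor (ℓ 2 ∷ []) (ℓ 1 ∷ ℓ⁻¹ 3 ∷ ℓ 4 ∷ []) (ℓ⁻¹ 0 ∷ ℓ 4 ∷ []) (ℓ 4 ∷ [])
  ∷ tensor (minus ∷ []) [] (ℓ 1 ∷ []) (ℓ 4 ∷ [])
  ∷ tensor (ℓ 2 ∷ []) (minus ∷ ℓ 4 ∷ []) (ℓ 1 ∷ []) (ℓ 4 ∷ [])
  ∷ tensor (ℓ 1 ∷ []) (ℓ⁻¹ 0 ∷ []) [] (ℓ⁻¹ 0 ∷ [])
  ∷ tensor (minus ∷ []) (ℓ 1 ∷ []) [] (ℓ⁻¹ 0 ∷ [])
  ∷ tensor (ℓ 1 ∷ []) (minus ∷ ℓ⁻¹ 0 ∷ ℓ 3 ∷ []) (ℓ⁻¹ 0 ∷ ℓ 4 ∷ []) (ℓ⁻¹ 0 ∷ [])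
  ∷ tensor (ℓ 2 ∷ []) (ℓ 1 ∷ ℓ⁻¹ 3 ∷ ℓ 4 ∷ []) (ℓ⁻¹ 0 ∷ ℓ 4 ∷ []) (ℓ⁻¹ 0 ∷ [])
  ∷ tensor (minus ∷ []) [] (ℓ 1 ∷ []) (ℓ⁻¹ 0 ∷ [])
  ∷ tensor (ℓ 2 ∷ []) (minus ∷ ℓ 4 ∷ []) (ℓ 1 ∷ []) (ℓ⁻¹ 0 ∷ [])
  ∷ tensor (minus ∷ []) [] [] (ℓ 1 ∷ [])
  ∷ tensor (minus ∷ []) (minus ∷ []) [] (ℓ 1 ∷ [])
  ∷ tensor (minus ∷ []) [] (ℓ 4 ∷ []) (ℓ 1 ∷ [])
  ∷ tensor (ℓ 2 ∷ []) (minus ∷ ℓ 4 ∷ []) (ℓ 4 ∷ []) (ℓ 1 ∷ [])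
  ∷ tensor (minus ∷ []) [] (minus ∷ []) (ℓ 1 ∷ [])
  ∷ tensor (ℓ 2 ∷ []) (minus ∷ ℓ 4 ∷ []) (minus ∷ []) (ℓ 1 ∷ [])
  ∷ [])

S₅ : List FactoredTerm
S₅ =
  ( tensor (minus ∷ ℓ⁻¹ 0 ∷ []) (minus ∷ ℓ 0 ∷ ℓ⁻¹ 1 ∷ []) [] []
  ∷ tensor (minus ∷ []) (minus ∷ ℓ⁻¹ 0 ∷ []) [] []
  ∷ tensor (minus ∷ ℓ⁻¹ 0 ∷ []) (minus ∷ ℓ 0 ∷ ℓ⁻¹ 1 ∷ []) (minus ∷ ℓ 0 ∷ ℓ⁻¹ 1 ∷ []) []
  ∷ tensor (minus ∷ []) (minus ∷ ℓ⁻¹ 0 ∷ []) (minus ∷ ℓ 0 ∷ ℓ⁻¹ 1 ∷ []) []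
  ∷ tensor (minus ∷ []) [] (minus ∷ ℓ⁻¹ 0 ∷ []) []
  ∷ tensor (minus ∷ []) (minus ∷ []) (minus ∷ ℓ⁻¹ 0 ∷ []) []
  ∷ tensor (minus ∷ ℓ⁻¹ 0 ∷ []) (minus ∷ ℓ 0 ∷ ℓ⁻¹ 1 ∷ []) [] (minus ∷ ℓ 2 ∷ ℓ⁻¹ 4 ∷ [])
  ∷ tensor (minus ∷ []) (minus ∷ ℓ⁻¹ 0 ∷ []) [] (minus ∷ ℓ 2 ∷ ℓ⁻¹ 4 ∷ [])
  ∷ tensor (minus ∷ ℓ⁻¹ 0 ∷ []) (ℓ⁻¹ 1 ∷ ℓ 3 ∷ ℓ⁻¹ 4 ∷ []) (ℓ 0 ∷ ℓ⁻¹ 1 ∷ ℓ 2 ∷ ℓ⁻¹ 4 ∷ []) (minus ∷ ℓ 2 ∷ ℓ⁻¹ 4 ∷ [])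
  ∷ tensor (minus ∷ ℓ⁻¹ 4 ∷ []) (ℓ 2 ∷ ℓ⁻¹ 3 ∷ []) (ℓ 0 ∷ ℓ⁻¹ 1 ∷ ℓ 2 ∷ ℓ⁻¹ 4 ∷ []) (minus ∷ ℓ 2 ∷ ℓ⁻¹ 4 ∷ [])
  ∷ tensor (minus ∷ []) [] (minus ∷ ℓ⁻¹ 0 ∷ []) (minus ∷ ℓ 2 ∷ ℓ⁻¹ 4 ∷ [])
  ∷ tensor (minus ∷ ℓ⁻¹ 4 ∷ []) (ℓ 2 ∷ ℓ⁻¹ 4 ∷ []) (minus ∷ ℓ⁻¹ 0 ∷ []) (minus ∷ ℓ 2 ∷ ℓ⁻¹ 4 ∷ [])
  ∷ tensor (minus ∷ ℓ⁻¹ 0 ∷ []) (minus ∷ ℓ 0 ∷ ℓ⁻¹ 1 ∷ []) [] (minus ∷ ℓ 0 ∷ ℓ⁻¹ 1 ∷ [])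
  ∷ tensor (minus ∷ []) (minus ∷ ℓ⁻¹ 0 ∷ []) [] (minus ∷ ℓ 0 ∷ ℓ⁻¹ 1 ∷ [])
  ∷ tensor (minus ∷ ℓ⁻¹ 0 ∷ []) (ℓ⁻¹ 1 ∷ ℓ 3 ∷ ℓ⁻¹ 4 ∷ []) (ℓ 0 ∷ ℓ⁻¹ 1 ∷ ℓ 2 ∷ ℓ⁻¹ 4 ∷ []) (minus ∷ ℓ 0 ∷ ℓ⁻¹ 1 ∷ [])
  ∷ tensor (minus ∷ ℓ⁻¹ 4 ∷ []) (ℓ 2 ∷ ℓ⁻¹ 3 ∷ []) (ℓ 0 ∷ ℓ⁻¹ 1 ∷ ℓ 2 ∷ ℓ⁻¹ 4 ∷ []) (minus ∷ ℓ 0 ∷ ℓ⁻¹ 1 ∷ [])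
  ∷ tensor (minus ∷ []) [] (minus ∷ ℓ⁻¹ 0 ∷ []) (minus ∷ ℓ 0 ∷ ℓ⁻¹ 1 ∷ [])
  ∷ tensor (minus ∷ ℓ⁻¹ 4 ∷ []) (ℓ 2 ∷ ℓ⁻¹ 4 ∷ []) (minus ∷ ℓ⁻¹ 0 ∷ []) (minus ∷ ℓ 0 ∷ ℓ⁻¹ 1 ∷ [])
  ∷ tensor (minus ∷ []) [] [] (minus ∷ ℓ⁻¹ 0 ∷ [])
  ∷ tensor (minus ∷ []) (minus ∷ []) [] (minus ∷ ℓ⁻¹ 0 ∷ [])
  ∷ tensor (minus ∷ []) [] (minus ∷ ℓ 2 ∷ ℓ⁻¹ 4 ∷ []) (minus ∷ ℓ⁻¹ 0 ∷ [])
  ∷ tensor (minus ∷ ℓ⁻¹ 4 ∷ []) (ℓ 2 ∷ ℓ⁻¹ 4 ∷ []) (minus ∷ ℓ 2 ∷ ℓ⁻¹ 4 ∷ []) (minus ∷ ℓ⁻¹ 0 ∷ [])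
  ∷ tensor (minus ∷ []) [] (minus ∷ []) (minus ∷ ℓ⁻¹ 0 ∷ [])
  ∷ tensor (minus ∷ ℓ⁻¹ 4 ∷ []) (ℓ 2 ∷ ℓ⁻¹ 4 ∷ []) (minus ∷ []) (minus ∷ ℓ⁻¹ 0 ∷ [])
  ∷ [])

S₆ : List FactoredTerm
S₆ =
  ( tensor (ℓ⁻¹ 1 ∷ []) (minus ∷ ℓ⁻¹ 0 ∷ ℓ 1 ∷ []) [] []
  ∷ tensor (minus ∷ []) (ℓ⁻¹ 1 ∷ []) [] []
  ∷ tensor (ℓ⁻¹ 1 ∷ []) (minus ∷ ℓ⁻¹ 0 ∷ ℓ 1 ∷ []) (minus ∷ ℓ⁻¹ 0 ∷ ℓ 1 ∷ []) []
  ∷ tensor (minus ∷ []) (ℓ⁻¹ 1 ∷ []) (minus ∷ ℓ⁻¹ 0 ∷ ℓ 1 ∷ []) []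
  ∷ tensor (minus ∷ []) [] (ℓ⁻¹ 1 ∷ []) []
  ∷ tensor (minus ∷ []) (minus ∷ []) (ℓ⁻¹ 1 ∷ []) []
  ∷ tensor (ℓ⁻¹ 1 ∷ []) (minus ∷ ℓ⁻¹ 0 ∷ ℓ 1 ∷ []) [] (minus ∷ ℓ⁻¹ 2 ∷ ℓ 4 ∷ [])
  ∷ tensor (minus ∷ []) (ℓ⁻¹ 1 ∷ []) [] (minus ∷ ℓ⁻¹ 2 ∷ ℓ 4 ∷ [])
  ∷ tensor (ℓ⁻¹ 1 ∷ []) (minus ∷ ℓ⁻¹ 0 ∷ ℓ⁻¹ 2 ∷ ℓ 3 ∷ []) (ℓ⁻¹ 0 ∷ ℓ 1 ∷ ℓ⁻¹ 2 ∷ ℓ 4 ∷ []) (minus ∷ ℓ⁻¹ 2 ∷ ℓ 4 ∷ [])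
  ∷ tensor (ℓ⁻¹ 2 ∷ []) (ℓ⁻¹ 3 ∷ ℓ 4 ∷ []) (ℓ⁻¹ 0 ∷ ℓ 1 ∷ ℓ⁻¹ 2 ∷ ℓ 4 ∷ []) (minus ∷ ℓ⁻¹ 2 ∷ ℓ 4 ∷ [])
  ∷ tensor (minus ∷ []) [] (ℓ⁻¹ 1 ∷ []) (minus ∷ ℓ⁻¹ 2 ∷ ℓ 4 ∷ [])
  ∷ tensor (ℓ⁻¹ 2 ∷ []) (ℓ⁻¹ 2 ∷ ℓ 4 ∷ []) (ℓ⁻¹ 1 ∷ []) (minus ∷ ℓ⁻¹ 2 ∷ ℓ 4 ∷ [])
  ∷ tensor (ℓ⁻¹ 1 ∷ []) (minus ∷ ℓ⁻¹ 0 ∷ ℓ 1 ∷ []) [] (minus ∷ ℓ⁻¹ 0 ∷ ℓ 1 ∷ [])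
  ∷ tensor (minus ∷ []) (ℓ⁻¹ 1 ∷ []) [] (minus ∷ ℓ⁻¹ 0 ∷ ℓ 1 ∷ [])
  ∷ tensor (ℓ⁻¹ 1 ∷ []) (minus ∷ ℓ⁻¹ 0 ∷ ℓ⁻¹ 2 ∷ ℓ 3 ∷ []) (ℓ⁻¹ 0 ∷ ℓ 1 ∷ ℓ⁻¹ 2 ∷ ℓ 4 ∷ []) (minus ∷ ℓ⁻¹ 0 ∷ ℓ 1 ∷ [])
  ∷ tensor (ℓ⁻¹ 2 ∷ []) (ℓ⁻¹ 3 ∷ ℓ 4 ∷ []) (ℓ⁻¹ 0 ∷ ℓ 1 ∷ ℓ⁻¹ 2 ∷ ℓ 4 ∷ []) (minus ∷ ℓ⁻¹ 0 ∷ ℓ 1 ∷ [])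
  ∷ tensor (minus ∷ []) [] (ℓ⁻¹ 1 ∷ []) (minus ∷ ℓ⁻¹ 0 ∷ ℓ 1 ∷ [])
  ∷ tensor (ℓ⁻¹ 2 ∷ []) (ℓ⁻¹ 2 ∷ ℓ 4 ∷ []) (ℓ⁻¹ 1 ∷ []) (minus ∷ ℓ⁻¹ 0 ∷ ℓ 1 ∷ [])
  ∷ tensor (minus ∷ []) [] [] (ℓ⁻¹ 1 ∷ [])
  ∷ tensor (minus ∷ []) (minus ∷ []) [] (ℓ⁻¹ 1 ∷ [])
  ∷ tensor (minus ∷ []) [] (minus ∷ ℓ⁻¹ 2 ∷ ℓ 4 ∷ []) (ℓ⁻¹ 1 ∷ [])
  ∷ tensor (ℓ⁻¹ 2 ∷ []) (ℓ⁻¹ 2 ∷ ℓ 4 ∷ []) (minus ∷ ℓ⁻¹ 2 ∷ ℓ 4 ∷ []) (ℓ⁻¹ 1 ∷ [])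
  ∷ tensor (minus ∷ []) [] (minus ∷ []) (ℓ⁻¹ 1 ∷ [])
  ∷ tensor (ℓ⁻¹ 2 ∷ []) (ℓ⁻¹ 2 ∷ ℓ 4 ∷ []) (minus ∷ []) (ℓ⁻¹ 1 ∷ [])
  ∷ [])

reduces₁ : 𝒮I₃₁ xF yF ∼ ⟦ normalForm ⟧ˡ
reduces₁ = certified _ S₁ normalForm tt

reduces₂ : 𝒮I₃₁ (oneF -F xF) (oneF -F yF) ∼ ⟦ normalForm ⟧ˡ
reduces₂ = certified _ S₂ normalForm tt

reduces₃ : 𝒮I₃₁ (oneF ÷F xF) (oneF ÷F yF) ∼ ⟦ normalForm ⟧ˡ
reduces₃ = certified _ S₃ normalForm tt

reduces₄ : 𝒮I₃₁ (oneF ÷F (oneF -F xF)) (oneF ÷F (oneF -F yF)) ∼ ⟦ normalForm ⟧ˡ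
reduces₄ = certified _ S₄ normalForm tt

reduces₅ : 𝒮I₃₁ (oneF -F (oneF ÷F xF)) (oneF -F (oneF ÷F yF)) ∼ ⟦ normalForm ⟧ˡ
reduces₅ = certified _ S₅ normalForm tt

reduces₆ : 𝒮I₃₁ (xF ÷F (xF -F oneF)) (yF ÷F (yF -F oneF)) ∼ ⟦ normalForm ⟧ˡ
reduces₆ = certified _ S₆ normalForm tt

mainTheorem5 :
    (𝒮I₃₁ xF yF =δ 𝒮I₃₁ (oneF -F xF) (oneF -F yF))
    × (𝒮I₃₁ (oneF -F xF) (oneF -F yF) =δ 𝒮I₃₁ (oneF ÷F xF) (oneF ÷F yF))
    × (𝒮I₃₁ (oneF ÷F xF) (oneF ÷F yF) =δ 𝒮I₃₁ (oneF ÷F (oneF -F xF)) (oneF ÷F (oneF -F yF)))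
    × (𝒮I₃₁ (oneF ÷F (oneF -F xF)) (oneF ÷F (oneF -F yF)) =δ 𝒮I₃₁ (oneF -F (oneF ÷F xF)) (oneF -F (oneF ÷F yF)))
    × (𝒮I₃₁ (oneF -F (oneF ÷F xF)) (oneF -F (oneF ÷F yF)) =δ 𝒮I₃₁ (xF ÷F (xF -F oneF)) (yF ÷F (yF -F oneF)))
mainTheorem5 =
    via-normal-form reduces₁ reduces₂
  , via-normal-form reduces₂ reduces₃
  , via-normal-form reduces₃ reduces₄
  , via-normal-form reduces₄ reduces₅
  , via-normal-form reduces₅ reduces₆
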